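{- Let $E$ be a finite nonempty set and $u:2^E\to\mathbb{R}$ ordinally w-concave. A set $X\in 2^E$ maximizes $u$ over $2^E$ if and only if $u(X)\ge u(Z)$ for all $Z\in\mathbf{N}(X)$.
   Context: Notation: for $X\subseteq E$ and $x\in E\setminus X$, $X+x=X\cup\{x\}$; for $x\in X$, $X-x=X\setminus\{x\}$. The symbol $\emptyset$ is also used as a formal element not in $E$, with $X+\emptyset=X-\emptyset=X$. A function $u:2^E\to\mathbb{R}$ is ordinally w-concave if for every $X,X'\in 2^E$ with $X\neq X'$ there exist distinct $x\in(X\setminus X')\cup\{\emptyset\}$ and $x'\in(X'\setminus X)\cup\{\emptyset\}$ such that (i) $u(X)<u(X-x+x')$, or (ii) $u(X')<u(X'-x'+x)$, or (iii) $u(X)=u(X-x+x')$ and $u(X')=u(X'-x'+x)$. The neighborhood of $X$ is $\mathbf{N}(X)=\{X-x+x'\mid x\in X\cup\{\emptyset\},\ x'\in(E\setminus X)\cup\{\emptyset\}\}$. -}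

module Defs where

open import Level using (Level)
open import Data.Nat using (ℕ; suc)
open import Data.Fin using (Fin)
open import Data.Fin.Subset using (Subset; _∈_; _∉_; _-_; _∪_; ⁅_⁆)
open import Data.Maybe using (Maybe; just; nothing)
open import Data.Product using (Σ; _×_; ∃; ∃-syntax)
open import Data.Sum using (_⊎_)
open import Data.Unit using (⊤)
open import Relation.Nullary using (¬_)
open import Relation.Binary.PropositionalEquality using (_≡_)
open import Relation.Binary.Bundles using (StrictTotalOrder)

-- Ground set E = Fin (suc n) (finite, nonempty); 2^E = Subset (suc n).
-- The formal element ∅ is represented by `nothing : Maybe (Fin m)`.

remove : ∀ {m} → Subset m → Maybe (Fin m) → Subset m
remove X nothing  = X
remove X (just x) = X - x

add : ∀ {m} → Subset m → Maybe (Fin m) → Subset m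
add X nothing   = X
add X (just x') = X ∪ ⁅ x' ⁆

exch : ∀ {m} → Subset m → Maybe (Fin m) → Maybe (Fin m) → Subset m
exch X x x' = add (remove X x) x'

InDiffOrEmpty : ∀ {m} → Maybe (Fin m) → Subset m → Subset m → Set
InDiffOrEmpty nothing  A B = ⊤
InDiffOrEmpty (just x) A B = (x ∈ A) × (x ∉ B)

InOrEmpty : ∀ {m} → Maybe (Fin m) → Subset m → Set
InOrEmpty nothing  X = ⊤
InOrEmpty (just x) X = x ∈ X

OutOrEmpty : ∀ {m} → Maybe (Fin m) → Subset m → Set
OutOrEmpty nothing  X = ⊤
OutOrEmpty (just x) X = x ∉ X

InNbhd : ∀ {m} → Subset m → Subset m → Set
InNbhd X Z = ∃[ x ] ∃[ x' ] (InOrEmpty x X × OutOrEmpty x' X × Z ≡ exch X x x')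

module _ {c ℓ₁ ℓ₂ : Level} (S : StrictTotalOrder c ℓ₁ ℓ₂) where
  open StrictTotalOrder S renaming (Carrier to R)

  _≥R_ : R → R → Set (ℓ₁ Level.⊔ ℓ₂)
  _≥R_ a b = (b < a) ⊎ (b ≈ a)

  OrdinallyWConcave : ∀ {m} → (Subset m → R) → Set (ℓ₁ Level.⊔ ℓ₂)
  OrdinallyWConcave {m} u =
    ∀ (X X' : Subset m) → ¬ (X ≡ X') →
      ∃[ x ] ∃[ x' ]
        ( InDiffOrEmpty x X X'
        × InDiffOrEmpty x' X' X
        × ¬ (x ≡ x')
        × ( (u X < u (exch X x x'))
          ⊎ (u X' < u (exch X' x' x))
          ⊎ ((u X ≈ u (exch X x x')) × (u X' ≈ u (exch X' x' x))) ) )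

  Maximizes : ∀ {m} → (Subset m → R) → Subset m → Set (ℓ₁ Level.⊔ ℓ₂)
  Maximizes {m} u X = ∀ (Z : Subset m) → u X ≥R u Z

  LocalMax : ∀ {m} → (Subset m → R) → Subset m → Set (ℓ₁ Level.⊔ ℓ₂)
  LocalMax {m} u X = ∀ (Z : Subset m) → InNbhd X Z → u X ≥R u Z

module Submission where

open import Defs
open import Level using (Level)
open import Data.Nat using (ℕ; suc; _+_; _<_; s≤s)
open import Data.Nat.Induction using (<-wellFounded)
open import Data.Nat.Properties using (≤-refl; ≤-reflexive; <-trans; +-monoʳ-<)
open import Data.Bool using (true; false; _xor_; if_then_else_; _≟_)
open import Data.Bool.Properties using (∨-identityʳ)
open import Data.Fin using (Fin)
open import Data.Fin.Subset using (Subset; _∪_; _-_; ⁅_⁆; _∈_; _∉_)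
open import Data.Fin.Subset.Properties using (∪-identityʳ; p─q⊆p)
open import Data.Vec using ([]; _∷_; here; there)
open import Data.Vec.Properties using (≡-dec; zipWith-identityʳ)
open import Data.Maybe using (Maybe; just; nothing)
open import Data.Product using (_×_; _,_; ∃-syntax)
open import Data.Sum using (_⊎_; inj₁; inj₂)
open import Data.Empty using (⊥-elim)
open import Function using (_∘_)
open import Induction.WellFounded using (Acc; acc)
open import Relation.Nullary using (yes; no)
open import Relation.Binary.PropositionalEquality using (_≢_; refl; cong)
open import Relation.Binary.Bundles using (StrictTotalOrder)
import Relation.Binary.Construct.StrictToNonStrict as StrictToNonStrict

-- Idea: measure how far Y is from X by the Hamming distance. For a local
-- maximum X and any Y ≠ X, alternative (i) of w-concavity for the pair (X, Y)
-- would exhibit a neighbour of X better than X, so one of the other two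
-- alternatives holds: the exchange Y - x' + x is at least as good as Y and,
-- since x ∈ X ∖ Y and x' ∈ Y ∖ X, strictly closer to X. Induction on the
-- distance gives u Y ≤ u X.

hamming : ∀ {m} → Subset m → Subset m → ℕ
hamming []      []      = 0
hamming (a ∷ X) (b ∷ Y) = (if a xor b then 1 else 0) + hamming X Y

hamming-∪⁅⁆-< : ∀ {m} {X Y : Subset m} {x} → x ∈ X → x ∉ Y →
                hamming X (Y ∪ ⁅ x ⁆) < hamming X Y
hamming-∪⁅⁆-< {X = true ∷ X} {true  ∷ Y} here         x∉Y = ⊥-elim (x∉Y here)
hamming-∪⁅⁆-< {X = true ∷ X} {false ∷ Y} here         _   rewrite ∪-identityʳ Y = ≤-refl
hamming-∪⁅⁆-< {X = a ∷ X}    {b ∷ Y}     (there x∈X) x∉Y rewrite ∨-identityʳ b =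
  +-monoʳ-< _ (hamming-∪⁅⁆-< x∈X (x∉Y ∘ there))

hamming-remove-< : ∀ {m} {X Y : Subset m} {x} → x ∉ X → x ∈ Y →
                   hamming X (Y - x) < hamming X Y
hamming-remove-< {X = true  ∷ X} {Y}         x∉X here        = ⊥-elim (x∉X here)
-- The tail of Y - zero is a zipWith of the helper local to (true ∷ Y) ─ _,
-- not Y ─ ⊥, so p─⊥≡p does not apply.
hamming-remove-< {X = false ∷ X} {true ∷ Y}  _   here        =
  s≤s (≤-reflexive (cong (hamming X) (zipWith-identityʳ (λ _ → refl) Y)))
hamming-remove-< {X = a ∷ X}     {b ∷ Y}     x∉X (there x∈Y) =
  +-monoʳ-< _ (hamming-remove-< (x∉X ∘ there) x∈Y)

hamming-exch-< : ∀ {m} {X Y : Subset m} (x x' : Maybe (Fin m)) →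
                 InDiffOrEmpty x X Y → InDiffOrEmpty x' Y X → x ≢ x' →
                 hamming X (exch Y x' x) < hamming X Y
hamming-exch-< nothing  nothing  _             _             x≢x' = ⊥-elim (x≢x' refl)
hamming-exch-< (just a) nothing  (a∈X , a∉Y)   _             _    = hamming-∪⁅⁆-< a∈X a∉Y
hamming-exch-< nothing  (just b) _             (b∈Y , b∉X)   _    = hamming-remove-< b∉X b∈Y
hamming-exch-< {Y = Y} (just a) (just b) (a∈X , a∉Y) (b∈Y , b∉X) _ =
  <-trans (hamming-∪⁅⁆-< a∈X (a∉Y ∘ p─q⊆p Y ⁅ b ⁆)) (hamming-remove-< b∉X b∈Y)

exch-∈-nbhd : ∀ {m} {X Y : Subset m} (x x' : Maybe (Fin m)) →
              InDiffOrEmpty x X Y → InDiffOrEmpty x' Y X → InNbhd X (exch X x x')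
exch-∈-nbhd nothing  nothing  _         _          = nothing , nothing , _ , _ , refl
exch-∈-nbhd (just a) nothing  (a∈X , _) _          = just a , nothing , a∈X , _ , refl
exch-∈-nbhd nothing  (just b) _         (_ , b∉X)  = nothing , just b , _ , b∉X , refl
exch-∈-nbhd (just a) (just b) (a∈X , _) (_ , b∉X)  = just a , just b , a∈X , b∉X , refl

module _ {c ℓ₁ ℓ₂ : Level} (S : StrictTotalOrder c ℓ₁ ℓ₂) where
  open StrictTotalOrder S using (_≈_; module Eq; irrefl; trans; <-respʳ-≈)
    renaming (Carrier to R; _<_ to _≺_)
  open StrictToNonStrict _≈_ _≺_ using (_≤_; <-≤-trans)
  open import Relation.Binary.Properties.StrictTotalOrder S using ()
    renaming (trans to ≤-trans)

  module _ {m} {u : Subset m → R} (wc : OrdinallyWConcave S u)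
           {X : Subset m} (X-localMax : LocalMax S u X) where

    exchange-ascends : ∀ {Y} → X ≢ Y → ∃[ Y' ] hamming X Y' < hamming X Y × u Y ≤ u Y'
    exchange-ascends {Y} X≢Y with wc X Y X≢Y
    ... | x , x' , x∈X∖Y , x'∈Y∖X , x≢x' , alternatives =
      exch Y x' x , hamming-exch-< x x' x∈X∖Y x'∈Y∖X x≢x' , ascends alternatives
      where
      ascends : u X ≺ u (exch X x x') ⊎ u Y ≺ u (exch Y x' x)
                  ⊎ (u X ≈ u (exch X x x') × u Y ≈ u (exch Y x' x)) →
                u Y ≤ u (exch Y x' x)
      ascends (inj₁ uX<uX') = ⊥-elim (irrefl Eq.refl
        (<-≤-trans trans <-respʳ-≈ uX<uX' (X-localMax _ (exch-∈-nbhd x x' x∈X∖Y x'∈Y∖X))))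
      ascends (inj₂ (inj₁ uY<uY'))      = inj₁ uY<uY'
      ascends (inj₂ (inj₂ (_ , uY≈uY'))) = inj₂ uY≈uY'

    localMax⇒maximizes : Maximizes S u X
    localMax⇒maximizes Y = ascend Y (<-wellFounded (hamming X Y))
      where
      ascend : ∀ Y → Acc _<_ (hamming X Y) → u Y ≤ u X
      ascend Y (acc closer) with ≡-dec _≟_ X Y
      ... | yes refl = inj₂ Eq.refl
      ... | no X≢Y with exchange-ascends X≢Y
      ... | Y' , Y'-closer , uY≤uY' = ≤-trans uY≤uY' (ascend Y' (closer Y'-closer))

corollary2p8 : ∀ {c ℓ₁ ℓ₂ : Level} (S : StrictTotalOrder c ℓ₁ ℓ₂) (n : ℕ)
                 (u : Subset (suc n) → StrictTotalOrder.Carrier S) →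
                 OrdinallyWConcave S u → (X : Subset (suc n)) →
                 (Maximizes S u X → LocalMax S u X) × (LocalMax S u X → Maximizes S u X)
corollary2p8 S n u wc X = (λ X-max Z _ → X-max Z) , localMax⇒maximizes S wc
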